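{- For any integer $r \geq 2$, there exist graphs $G$ and $H$ such that $G \,\square\, H$ contains a universal line (so $\mathrm{gp}^-(G\,\square\,H) = 2$) and $\min\{\mathrm{tp}^-(G), \mathrm{tp}^-(H)\} = r$.
   Context: All graphs are simple and undirected. For vertices $u,v$ of $G$, the line $\mathcal{L}(u,v) = \{w : d(u,v) = d(u,w)+d(w,v) \text{ or } d(u,v) = |d(u,w)-d(w,v)|\}$, which is universal if it equals $V(G)$. A set $S \subseteq V(G)$ is in general position if no shortest path of $G$ contains three vertices of $S$; $\mathrm{gp}^-(G)$ is the order of a smallest maximal general position set. A terminal set of $G$ is a maximal general position set $S$ such that every $u \in V(G)\setminus S$ is an endpoint of a shortest path containing at least two vertices of $S$; $\mathrm{tp}^-(G)$ is the order of a smallest terminal set ($\infty$ if none exists). The Cartesian product $G \,\square\, H$ has vertex set $V(G)\times V(H)$, with $(u_1,v_1) \sim (u_2,v_2)$ iff either $u_1=u_2$ and $v_1 \sim v_2$ in $H$, or $u_1 \sim u_2$ in $G$ and $v_1 = v_2$. -}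

module Defs where

open import Level using (0ℓ)
open import Data.Nat using (ℕ; zero; suc; _+_; _≤_; _<_)
open import Data.Nat.Properties using (≤-refl)
open import Data.Maybe using (Maybe; just; nothing)
open import Data.List using (List; []; _∷_; length; cartesianProduct)
open import Data.List.Membership.Propositional using (_∈_; _∉_)
open import Data.List.Membership.Propositional.Properties using (∈-cartesianProduct⁺)
open import Data.List.Relation.Unary.Unique.Propositional using (Unique)
open import Data.Product using (Σ; ∃; _×_; _,_; proj₁; proj₂)
open import Data.Sum using (_⊎_; inj₁; inj₂)
open import Data.Empty using (⊥)
open import Relation.Nullary using (¬_)
open import Relation.Binary.PropositionalEquality using (_≡_; _≢_; refl)

record Graph : Set₁ where
  field
    V       : Set
    _~_     : V → V → Set
    ~-sym   : ∀ {u v} → u ~ v → v ~ u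
    ~-irrefl : ∀ {u} → ¬ (u ~ u)
    -- finiteness: an enumeration of all vertices
    enum     : List V
    complete : ∀ v → v ∈ enum

open Graph public

data ProdAdj (G H : Graph) : (V G × V H) → (V G × V H) → Set where
  inH : ∀ {u v₁ v₂} → _~_ H v₁ v₂ → ProdAdj G H (u , v₁) (u , v₂)
  inG : ∀ {u₁ u₂ v} → _~_ G u₁ u₂ → ProdAdj G H (u₁ , v) (u₂ , v)

_□_ : Graph → Graph → Graph
G □ H = record
  { V = V G × V H
  ; _~_ = ProdAdj G H
  ; ~-sym = symP
  ; ~-irrefl = irrP
  ; enum = cartesianProduct (enum G) (enum H)
  ; complete = λ { (u , v) → ∈-cartesianProduct⁺ (complete G u) (complete H v) }
  }
  where
  symP : ∀ {x y} → ProdAdj G H x y → ProdAdj G H y x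
  symP (inH a) = inH (~-sym H a)
  symP (inG a) = inG (~-sym G a)
  irrP : ∀ {x} → ¬ ProdAdj G H x x
  irrP (inH a) = ~-irrefl H a
  irrP (inG a) = ~-irrefl G a

module _ (G : Graph) where

  data Walk : V G → V G → ℕ → Set where
    here : ∀ {u} → Walk u u 0
    step : ∀ {u w v k} → _~_ G u w → Walk w v k → Walk u v (suc k)

  verts : ∀ {u v k} → Walk u v k → List (V G)
  verts (here {u}) = u ∷ []
  verts (step {u} _ p) = u ∷ verts p

  Connected : Set
  Connected = ∀ u v → Σ ℕ λ k → Walk u v k

  Dist : V G → V G → ℕ → Set
  Dist u v k = Walk u v k × (∀ m → m < k → Walk u v m → ⊥)

  IsGeodesic : ∀ {u v k} → Walk u v k → Set
  IsGeodesic {u} {v} {k} _ = Dist u v k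

  InLine : V G → V G → V G → Set
  InLine u v w = Σ ℕ λ a → Σ ℕ λ b → Σ ℕ λ c →
    Dist u v a × Dist u w b × Dist w v c ×
    (a ≡ b + c ⊎ (b ≡ a + c ⊎ c ≡ a + b))   -- a = b + c  or  a = |b - c|

  UniversalLine : V G → V G → Set
  UniversalLine u v = ∀ w → InLine u v w

  HasUniversalLine : Set
  HasUniversalLine = Σ (V G) λ u → Σ (V G) λ v → u ≢ v × UniversalLine u v

  -- vertex sets are duplicate-free lists; order = length
  _⊆_ : List (V G) → List (V G) → Set
  S ⊆ T = ∀ x → x ∈ S → x ∈ T

  GenPos : List (V G) → Set
  GenPos S = ∀ u v k (p : Walk u v k) → IsGeodesic p →
    ∀ x y z → x ∈ S → y ∈ S → z ∈ S → x ≢ y → y ≢ z → x ≢ z →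
    x ∈ verts p → y ∈ verts p → z ∈ verts p → ⊥

  MaxGenPos : List (V G) → Set
  MaxGenPos S = Unique S × GenPos S ×
    (∀ T → Unique T → S ⊆ T → GenPos T → T ⊆ S)

  TerminalWitness : List (V G) → V G → Set
  TerminalWitness S u = Σ (V G) λ v → Σ ℕ λ k →
    ((Σ (Walk u v k) λ p → IsGeodesic p × TwoIn (verts p))
     ⊎ (Σ (Walk v u k) λ p → IsGeodesic p × TwoIn (verts p)))
    where
    TwoIn : List (V G) → Set
    TwoIn P = Σ (V G) λ x → Σ (V G) λ y →
      x ∈ S × y ∈ S × x ≢ y × x ∈ P × y ∈ P

  Terminal : List (V G) → Set
  Terminal S = MaxGenPos S × (∀ u → u ∉ S → TerminalWitness S u)

  GpMinus : ℕ → Set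
  GpMinus k = (Σ (List (V G)) λ S → MaxGenPos S × length S ≡ k) ×
              (∀ S → MaxGenPos S → k ≤ length S)

  -- tp⁻(G) = t, with t = nothing meaning ∞ (no terminal set exists)
  TpMinus : Maybe ℕ → Set
  TpMinus (just k) = (Σ (List (V G)) λ S → Terminal S × length S ≡ k) ×
                     (∀ S → Terminal S → k ≤ length S)
  TpMinus nothing = ∀ S → Terminal S → ⊥

min∞ : Maybe ℕ → Maybe ℕ → Maybe ℕ
min∞ nothing b = b
min∞ (just a) nothing = just a
min∞ (just a) (just b) = just (Data.Nat._⊓_ a b)

{-# OPTIONS --safe #-}

-- Take G = H = K_{r+1} minus one edge pole₁ pole₂, a graph of diameter 2.
-- Every vertex of G lies on a shortest pole₁–pole₂ path, and distances in
-- G □ H add up coordinatewise, so every vertex of G □ H lies on a shortest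
-- (pole₁,pole₁)–(pole₂,pole₂) path: this line is universal, and a universal
-- line L(u,v) makes {u,v} a maximal general position set, whence gp⁻ = 2.
-- In G, a shortest path with three vertices runs from pole₁ to pole₂, so
-- every set avoiding pole₂ is in general position; in particular
-- pole₁ together with the r − 1 core vertices is a terminal set. Conversely
-- a terminal set must contain every core vertex (they have eccentricity 1)
-- and one of the poles, so tp⁻(G) = r.

module Submission where

open import Defs hiding (_⊆_)
open import Data.Nat using (ℕ; zero; suc; _+_; _≤_; _<_; z≤n; s≤s)
open import Data.Nat.Properties
  using (≤-antisym; ≮⇒≥; <⇒≱; ≤-trans; ≤-refl; ≤-reflexive; ≤-pred; +-mono-≤; +-suc; +-comm;
         ⊓-idem; +-commutativeSemigroup)
open import Algebra.Properties.CommutativeSemigroup +-commutativeSemigroup using (interchange)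
open import Data.Maybe using (Maybe; just)
open import Data.Product using (Σ; ∃₂; _×_; _,_; proj₁; proj₂)
open import Data.Product.Properties using (≡-dec)
open import Data.Sum using (_⊎_; inj₁; inj₂; [_,_]′)
open import Data.Unit using (⊤; tt)
open import Data.Empty using (⊥; ⊥-elim)
open import Data.Fin using (Fin; zero; suc)
import Data.Fin as Fin
open import Data.Fin.Properties using (injective⇒≤)
open import Data.List using (List; []; _∷_; length; lookup; tabulate)
open import Data.List.Properties using (length-tabulate)
open import Data.List.Membership.Propositional using (_∈_; _∉_)
open import Data.List.Membership.Propositional.Properties using (∈-lookup; ∈-tabulate⁺; ∈-tabulate⁻)
open import Data.List.Relation.Binary.Subset.Propositional using (_⊆_)
open import Data.List.Relation.Unary.Any using (here; there; index)
open import Data.List.Relation.Unary.Any.Properties using (lookup-index)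
open import Data.List.Relation.Unary.All using ([]; _∷_)
import Data.List.Relation.Unary.All as All
open import Data.List.Relation.Unary.All.Properties using (¬Any⇒All¬)
open import Data.List.Relation.Unary.AllPairs using ([]; _∷_)
open import Data.List.Relation.Unary.Unique.Propositional using (Unique)
open import Data.List.Relation.Unary.Unique.Propositional.Properties using (tabulate⁺)
open import Relation.Nullary using (¬_; yes; no)
open import Relation.Nullary.Decidable using (map′)
open import Relation.Binary.Definitions using (DecidableEquality)
open import Relation.Binary.PropositionalEquality
  using (_≡_; _≢_; refl; sym; trans; cong; subst; ≢-sym)

module _ {A : Set} where

  ∉-∈⇒≢ : ∀ {x y : A} {xs} → x ∉ xs → y ∈ xs → x ≢ y
  ∉-∈⇒≢ x∉xs y∈xs refl = x∉xs y∈xs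

  distinct₃ : ∀ {x y z : A} → x ≢ y → y ≢ z → x ≢ z → Unique (x ∷ y ∷ z ∷ [])
  distinct₃ x≢y y≢z x≢z = (x≢y ∷ x≢z ∷ []) ∷ (y≢z ∷ []) ∷ [] ∷ []

  lookup-injective : ∀ {xs : List A} → Unique xs → ∀ {i j} → lookup xs i ≡ lookup xs j → i ≡ j
  lookup-injective (_    ∷ _) {zero}  {zero}  _  = refl
  lookup-injective (x≢xs ∷ _) {zero}  {suc j} eq = ⊥-elim (All.lookup x≢xs (∈-lookup j) eq)
  lookup-injective (x≢xs ∷ _) {suc i} {zero}  eq = ⊥-elim (All.lookup x≢xs (∈-lookup i) (sym eq))
  lookup-injective (_    ∷ u) {suc i} {suc j} eq = cong suc (lookup-injective u eq)

  Unique-⊆⇒length≤ : ∀ {xs ys : List A} → Unique xs → xs ⊆ ys → length xs ≤ length ys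
  Unique-⊆⇒length≤ {xs} {ys} unique xs⊆ys = injective⇒≤ position-injective
    where
    position : Fin (length xs) → Fin (length ys)
    position i = index (xs⊆ys (∈-lookup i))

    position-injective : ∀ {i j} → position i ≡ position j → i ≡ j
    position-injective {i} {j} eq = lookup-injective unique
      (trans (lookup-index (xs⊆ys (∈-lookup i)))
        (trans (cong (lookup ys) eq) (sym (lookup-index (xs⊆ys (∈-lookup j))))))

module _ {G : Graph} where

  infixr 5 _++ʷ_

  _++ʷ_ : ∀ {u w v i j} → Walk G u w i → Walk G w v j → Walk G u v (i + j)
  here       ++ʷ q = q
  step e p   ++ʷ q = step e (p ++ʷ q)

  _▷_ : ∀ {u v w k} → Walk G u v k → _~_ G v w → Walk G u w (suc k)
  here     ▷ e = step e here
  step e p ▷ f = step e (p ▷ f)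

  reverse : ∀ {u v k} → Walk G u v k → Walk G v u k
  reverse here       = here
  reverse (step e p) = reverse p ▷ ~-sym G e

  head∈verts : ∀ {u v k} (p : Walk G u v k) → u ∈ verts G p
  head∈verts here       = here refl
  head∈verts (step _ _) = here refl

  last∈verts : ∀ {u v k} (p : Walk G u v k) → v ∈ verts G p
  last∈verts here       = here refl
  last∈verts (step _ p) = there (last∈verts p)

  ∈-verts-++ʷʳ : ∀ {u w v i j x} (p : Walk G u w i) (q : Walk G w v j) →
                 x ∈ verts G q → x ∈ verts G (p ++ʷ q)
  ∈-verts-++ʷʳ here       q x∈q = x∈q
  ∈-verts-++ʷʳ (step _ p) q x∈q = there (∈-verts-++ʷʳ p q x∈q)

  length-verts : ∀ {u v k} (p : Walk G u v k) → length (verts G p) ≡ suc k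
  length-verts here       = refl
  length-verts (step _ p) = cong suc (length-verts p)

  distinct₃-on-walk⇒2≤length : ∀ {u v k x y z} (p : Walk G u v k) →
    x ≢ y → y ≢ z → x ≢ z → x ∈ verts G p → y ∈ verts G p → z ∈ verts G p → 2 ≤ k
  distinct₃-on-walk⇒2≤length p x≢y y≢z x≢z x∈p y∈p z∈p =
    ≤-pred (subst (3 ≤_) (length-verts p)
      (Unique-⊆⇒length≤ (distinct₃ x≢y y≢z x≢z) (All.lookup (x∈p ∷ y∈p ∷ z∈p ∷ []))))

  Dist-unique : ∀ {u v i j} → Dist G u v i → Dist G u v j → i ≡ j
  Dist-unique (p , i-minimal) (q , j-minimal) =
    ≤-antisym (≮⇒≥ λ j<i → i-minimal _ j<i q) (≮⇒≥ λ i<j → j-minimal _ i<j p)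

data OnCommonGeodesic (G : Graph) (x y z : V G) : Set where
  through : ∀ {s t k} (p : Walk G s t k) → IsGeodesic G p →
            x ∈ verts G p → y ∈ verts G p → z ∈ verts G p → OnCommonGeodesic G x y z

module _ {G : Graph} where

  GenPos⇒¬OnCommonGeodesic : ∀ {S x y z} → GenPos G S → x ∈ S → y ∈ S → z ∈ S →
    x ≢ y → y ≢ z → x ≢ z → ¬ OnCommonGeodesic G x y z
  GenPos⇒¬OnCommonGeodesic gp x∈S y∈S z∈S x≢y y≢z x≢z (through p geodesic x∈p y∈p z∈p) =
    gp _ _ _ p geodesic _ _ _ x∈S y∈S z∈S x≢y y≢z x≢z x∈p y∈p z∈p

  -- The three cases are w between u and v, v between u and w, u between w and v.
  InLine⇒OnCommonGeodesic : ∀ {u v w} → InLine G u v w → OnCommonGeodesic G u v w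
  InLine⇒OnCommonGeodesic (a , b , c , uv , (q , _) , (r , _) , inj₁ a≡b+c) =
    through (q ++ʷ r) (subst (Dist G _ _) a≡b+c uv)
      (head∈verts (q ++ʷ r)) (last∈verts (q ++ʷ r)) (∈-verts-++ʷʳ q r (head∈verts r))
  InLine⇒OnCommonGeodesic (a , b , c , (p , _) , uw , (r , _) , inj₂ (inj₁ b≡a+c)) =
    through (p ++ʷ reverse r) (subst (Dist G _ _) b≡a+c uw)
      (head∈verts (p ++ʷ reverse r)) (∈-verts-++ʷʳ p (reverse r) (head∈verts (reverse r)))
      (last∈verts (p ++ʷ reverse r))
  InLine⇒OnCommonGeodesic (a , b , c , (p , _) , (q , _) , wv , inj₂ (inj₂ c≡a+b)) =
    through (reverse q ++ʷ p) (subst (Dist G _ _) (trans c≡a+b (+-comm a b)) wv)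
      (∈-verts-++ʷʳ (reverse q) p (head∈verts p)) (last∈verts (reverse q ++ʷ p))
      (head∈verts (reverse q ++ʷ p))

  terminalWitness⇒OnCommonGeodesic : ∀ {S u} → TerminalWitness G S u →
    ∃₂ λ x y → x ∈ S × y ∈ S × x ≢ y × OnCommonGeodesic G u x y
  terminalWitness⇒OnCommonGeodesic (_ , _ , inj₁ (p , geodesic , x , y , x∈S , y∈S , x≢y , x∈p , y∈p)) =
    x , y , x∈S , y∈S , x≢y , through p geodesic (head∈verts p) x∈p y∈p
  terminalWitness⇒OnCommonGeodesic (_ , _ , inj₂ (p , geodesic , x , y , x∈S , y∈S , x≢y , x∈p , y∈p)) =
    x , y , x∈S , y∈S , x≢y , through p geodesic (last∈verts p) x∈p y∈p

  length≤2⇒GenPos : ∀ {S} → length S ≤ 2 → GenPos G S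
  length≤2⇒GenPos |S|≤2 _ _ _ _ _ _ _ _ x∈S y∈S z∈S x≢y y≢z x≢z _ _ _ =
    <⇒≱ (Unique-⊆⇒length≤ (distinct₃ x≢y y≢z x≢z) (All.lookup (x∈S ∷ y∈S ∷ z∈S ∷ []))) |S|≤2

  -- Maximality forbids a singleton {a} when u ≢ v: neither u nor v can differ from a.
  MaxGenPos⇒2≤length : ∀ {u v} → u ≢ v → ∀ S → MaxGenPos G S → 2 ≤ length S
  MaxGenPos⇒2≤length {u} _ [] (_ , _ , maximal)
    with () ← maximal (u ∷ []) ([] ∷ []) (λ _ ()) (length≤2⇒GenPos (s≤s z≤n)) u (here refl)
  MaxGenPos⇒2≤length {u} {v} u≢v (a ∷ []) (_ , _ , maximal) =
    ⊥-elim (equals-a u λ u≡a → equals-a v λ v≡a → u≢v (trans u≡a (sym v≡a)))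
    where
    equals-a : ∀ b → b ≢ a → ⊥
    equals-a b b≢a with maximal (b ∷ a ∷ []) ((b≢a ∷ []) ∷ [] ∷ []) (λ _ → there)
                                (length≤2⇒GenPos ≤-refl) b (here refl)
    ... | here b≡a = b≢a b≡a
  MaxGenPos⇒2≤length _ (_ ∷ _ ∷ _) _ = s≤s (s≤s z≤n)

  UniversalLine⇒MaxGenPos : DecidableEquality (V G) → ∀ {u v} → u ≢ v →
    UniversalLine G u v → MaxGenPos G (u ∷ v ∷ [])
  UniversalLine⇒MaxGenPos _≟_ {u} {v} u≢v line =
    ((u≢v ∷ []) ∷ [] ∷ []) , length≤2⇒GenPos ≤-refl , maximal
    where
    maximal : ∀ T → Unique T → (∀ x → x ∈ u ∷ v ∷ [] → x ∈ T) → GenPos G T →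
              ∀ x → x ∈ T → x ∈ u ∷ v ∷ []
    maximal T _ uv⊆T gp x x∈T with x ≟ u | x ≟ v
    ... | yes x≡u | _       = here x≡u
    ... | no _    | yes x≡v = there (here x≡v)
    ... | no x≢u  | no x≢v  = ⊥-elim (GenPos⇒¬OnCommonGeodesic gp
            (uv⊆T u (here refl)) (uv⊆T v (there (here refl))) x∈T
            u≢v (≢-sym x≢v) (≢-sym x≢u) (InLine⇒OnCommonGeodesic (line x)))

  HasUniversalLine⇒GpMinus≡2 : DecidableEquality (V G) → HasUniversalLine G → GpMinus G 2
  HasUniversalLine⇒GpMinus≡2 _≟_ (u , v , u≢v , line) =
    (u ∷ v ∷ [] , UniversalLine⇒MaxGenPos _≟_ u≢v line , refl) , MaxGenPos⇒2≤length u≢v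

Between : (G : Graph) → V G → V G → V G → Set
Between G u v w = ∃₂ λ i j → Dist G u w i × Dist G w v j × Dist G u v (i + j)

Between⇒InLine : ∀ {G u v w} → Between G u v w → InLine G u v w
Between⇒InLine (i , j , uw , wv , uv) = i + j , i , j , uv , uw , wv , inj₁ refl

module _ {G H : Graph} where

  liftˡ : ∀ {a a' b k} → Walk G a a' k → Walk (G □ H) (a , b) (a' , b) k
  liftˡ here       = here
  liftˡ (step e p) = step (inG e) (liftˡ p)

  liftʳ : ∀ {a b b' k} → Walk H b b' k → Walk (G □ H) (a , b) (a , b') k
  liftʳ here       = here
  liftʳ (step e p) = step (inH e) (liftʳ p)

  project : ∀ {x y k} → Walk (G □ H) x y k → ∃₂ λ k₁ k₂ →
    Walk G (proj₁ x) (proj₁ y) k₁ × Walk H (proj₂ x) (proj₂ y) k₂ × k₁ + k₂ ≡ k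
  project here = 0 , 0 , here , here , refl
  project (step (inG e) p) with k₁ , k₂ , p₁ , p₂ , refl ← project p =
    suc k₁ , k₂ , step e p₁ , p₂ , refl
  project (step (inH e) p) with k₁ , k₂ , p₁ , p₂ , refl ← project p =
    k₁ , suc k₂ , p₁ , step e p₂ , +-suc k₁ k₂

  Dist-□ : ∀ {a a' b b' i j} → Dist G a a' i → Dist H b b' j →
           Dist (G □ H) (a , b) (a' , b') (i + j)
  Dist-□ {i = i} {j} (p , p-minimal) (q , q-minimal) = liftˡ p ++ʷ liftʳ q , no-shorter
    where
    no-shorter : ∀ m → m < i + j → Walk (G □ H) _ _ m → ⊥
    no-shorter m m<i+j r with m₁ , m₂ , r₁ , r₂ , refl ← project r =
      <⇒≱ m<i+j (+-mono-≤ (≮⇒≥ λ m₁<i → p-minimal m₁ m₁<i r₁)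
                          (≮⇒≥ λ m₂<j → q-minimal m₂ m₂<j r₂))

  Between-□ : ∀ {a a' b b' x y} → Between G a a' x → Between H b b' y →
              Between (G □ H) (a , b) (a' , b') (x , y)
  Between-□ (i , j , ax , xa' , aa') (k , l , by , yb' , bb') =
    i + k , j + l , Dist-□ ax by , Dist-□ xa' yb' ,
    subst (Dist (G □ H) _ _) (interchange i j k l) (Dist-□ aa' bb')

  Between-□⇒UniversalLine : ∀ {a a' b b'} → (∀ x → Between G a a' x) → (∀ y → Between H b b' y) →
                            UniversalLine (G □ H) (a , b) (a' , b')
  Between-□⇒UniversalLine between-G between-H (x , y) =
    Between⇒InLine (Between-□ (between-G x) (between-H y))

record PathMetric (G : Graph) : Set where
  field
    d       : V G → V G → ℕ
    walk    : ∀ u v → Walk G u v (d u v)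
    minimal : ∀ {u v k} → Walk G u v k → d u v ≤ k

module PathMetricProperties {G : Graph} (M : PathMetric G) where
  open PathMetric M

  dist : ∀ u v → Dist G u v (d u v)
  dist u v = walk u v , λ m m<d p → <⇒≱ m<d (minimal p)

  connected : Connected G
  connected u v = d u v , walk u v

  geodesic-length : ∀ {u v k} (p : Walk G u v k) → IsGeodesic G p → k ≡ d u v
  geodesic-length p geodesic = Dist-unique geodesic (dist _ _)

  between : ∀ {u v w} → d u v ≡ d u w + d w v → Between G u v w
  between {u} {v} {w} eq = d u w , d w v , dist u w , dist w v , subst (Dist G u v) eq (dist u v)

  -- u and two further vertices lie on the witnessing geodesic, which ends at u.
  outsideTerminal⇒eccentric : ∀ {S u} → u ∉ S → TerminalWitness G S u →
    Σ (V G) λ v → 2 ≤ d u v ⊎ 2 ≤ d v u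
  outsideTerminal⇒eccentric u∉S (v , _ , inj₁ (p , geodesic , _ , _ , x∈S , y∈S , x≢y , x∈p , y∈p)) =
    v , inj₁ (subst (2 ≤_) (geodesic-length p geodesic)
      (distinct₃-on-walk⇒2≤length p (∉-∈⇒≢ u∉S x∈S) x≢y (∉-∈⇒≢ u∉S y∈S) (head∈verts p) x∈p y∈p))
  outsideTerminal⇒eccentric u∉S (v , _ , inj₂ (p , geodesic , _ , _ , x∈S , y∈S , x≢y , x∈p , y∈p)) =
    v , inj₂ (subst (2 ≤_) (geodesic-length p geodesic)
      (distinct₃-on-walk⇒2≤length p (∉-∈⇒≢ u∉S x∈S) x≢y (∉-∈⇒≢ u∉S y∈S) (last∈verts p) x∈p y∈p))

data Vertex (n : ℕ) : Set where
  pole₁ pole₂ : Vertex n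
  core        : Fin (suc n) → Vertex n

module CompleteMinusEdge (n : ℕ) where

  Adjacent : Vertex n → Vertex n → Set
  Adjacent (core i) (core j) = i ≢ j
  Adjacent (core _) _        = ⊤
  Adjacent _        (core _) = ⊤
  Adjacent _        _        = ⊥

  Adjacent-sym : ∀ {u v} → Adjacent u v → Adjacent v u
  Adjacent-sym {core _} {core _} i≢j = ≢-sym i≢j
  Adjacent-sym {core _} {pole₁}  _   = tt
  Adjacent-sym {core _} {pole₂}  _   = tt
  Adjacent-sym {pole₁}  {core _} _   = tt
  Adjacent-sym {pole₂}  {core _} _   = tt
  Adjacent-sym {pole₁}  {pole₁}  ()
  Adjacent-sym {pole₁}  {pole₂}  ()
  Adjacent-sym {pole₂}  {pole₁}  ()
  Adjacent-sym {pole₂}  {pole₂}  ()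

  Adjacent-irrefl : ∀ {u} → ¬ Adjacent u u
  Adjacent-irrefl {core _} i≢i = i≢i refl
  Adjacent-irrefl {pole₁}  ()
  Adjacent-irrefl {pole₂}  ()

  cores : List (Vertex n)
  cores = tabulate core

  core∈cores : ∀ i → core i ∈ cores
  core∈cores = ∈-tabulate⁺ {f = core}

  every-vertex : ∀ v → v ∈ pole₁ ∷ pole₂ ∷ cores
  every-vertex pole₁    = here refl
  every-vertex pole₂    = there (here refl)
  every-vertex (core i) = there (there (core∈cores i))

  graph : Graph
  graph = record
    { V = Vertex n ; _~_ = Adjacent ; ~-sym = Adjacent-sym ; ~-irrefl = Adjacent-irrefl
    ; enum = pole₁ ∷ pole₂ ∷ cores ; complete = every-vertex }

  core-injective : ∀ {i j} → core {n} i ≡ core j → i ≡ j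
  core-injective refl = refl

  _≟_ : DecidableEquality (Vertex n)
  pole₁  ≟ pole₁  = yes refl
  pole₂  ≟ pole₂  = yes refl
  core i ≟ core j = map′ (cong core) core-injective (i Fin.≟ j)
  pole₁  ≟ pole₂  = no λ ()
  pole₁  ≟ core _ = no λ ()
  pole₂  ≟ pole₁  = no λ ()
  pole₂  ≟ core _ = no λ ()
  core _ ≟ pole₁  = no λ ()
  core _ ≟ pole₂  = no λ ()

  open import Data.List.Membership.DecPropositional _≟_ using (_∈?_)

  distance : Vertex n → Vertex n → ℕ
  distance pole₁    pole₁    = 0
  distance pole₂    pole₂    = 0
  distance pole₁    pole₂    = 2
  distance pole₂    pole₁    = 2
  distance (core i) (core j) with i Fin.≟ j
  ... | yes _ = 0
  ... | no  _ = 1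
  distance _        _        = 1

  walk : ∀ u v → Walk graph u v (distance u v)
  walk pole₁    pole₁    = here
  walk pole₂    pole₂    = here
  walk pole₁    pole₂    = step {w = core zero} tt (step tt here)
  walk pole₂    pole₁    = step {w = core zero} tt (step tt here)
  walk (core i) (core j) with i Fin.≟ j
  ... | yes refl = here
  ... | no  i≢j  = step i≢j here
  walk pole₁    (core _) = step tt here
  walk pole₂    (core _) = step tt here
  walk (core _) pole₁    = step tt here
  walk (core _) pole₂    = step tt here

  distance-refl : ∀ u → distance u u ≡ 0
  distance-refl pole₁ = refl
  distance-refl pole₂ = refl
  distance-refl (core i) with i Fin.≟ i
  ... | yes _   = refl
  ... | no  i≢i = ⊥-elim (i≢i refl)

  core-distance≤1 : ∀ i j → distance (core i) (core j) ≤ 1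
  core-distance≤1 i j with i Fin.≟ j
  ... | yes _ = z≤n
  ... | no  _ = ≤-refl

  core-eccentricity : ∀ i v → distance (core i) v ≤ 1
  core-eccentricity i pole₁    = ≤-refl
  core-eccentricity i pole₂    = ≤-refl
  core-eccentricity i (core j) = core-distance≤1 i j

  core-eccentricityʳ : ∀ i v → distance v (core i) ≤ 1
  core-eccentricityʳ i pole₁    = ≤-refl
  core-eccentricityʳ i pole₂    = ≤-refl
  core-eccentricityʳ i (core j) = core-distance≤1 j i

  distance≤1⊎pole₂ : ∀ u v → distance u v ≤ 1 ⊎ (distance u v ≡ 2 × (u ≡ pole₂ ⊎ v ≡ pole₂))
  distance≤1⊎pole₂ pole₁    pole₁    = inj₁ z≤n
  distance≤1⊎pole₂ pole₁    pole₂    = inj₂ (refl , inj₂ refl)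
  distance≤1⊎pole₂ pole₁    (core _) = inj₁ ≤-refl
  distance≤1⊎pole₂ pole₂    pole₁    = inj₂ (refl , inj₁ refl)
  distance≤1⊎pole₂ pole₂    pole₂    = inj₁ z≤n
  distance≤1⊎pole₂ pole₂    (core _) = inj₁ ≤-refl
  distance≤1⊎pole₂ (core i) v        = inj₁ (core-eccentricity i v)

  distance≤2 : ∀ u v → distance u v ≤ 2
  distance≤2 u v with distance≤1⊎pole₂ u v
  ... | inj₁ d≤1       = ≤-trans d≤1 (s≤s z≤n)
  ... | inj₂ (d≡2 , _) = ≤-reflexive d≡2

  Adjacent⇒distance≤1 : ∀ u v → Adjacent u v → distance u v ≤ 1
  Adjacent⇒distance≤1 pole₁    (core _) _ = ≤-refl
  Adjacent⇒distance≤1 pole₂    (core _) _ = ≤-refl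
  Adjacent⇒distance≤1 (core i) v        _ = core-eccentricity i v

  walk-minimal : ∀ {u v k} → Walk graph u v k → distance u v ≤ k
  walk-minimal {u}     here                = ≤-reflexive (distance-refl u)
  walk-minimal {u} {v} (step e here)       = Adjacent⇒distance≤1 u v e
  walk-minimal {u} {v} (step _ (step _ _)) = ≤-trans (distance≤2 u v) (s≤s (s≤s z≤n))

  metric : PathMetric graph
  metric = record { d = distance ; walk = walk ; minimal = walk-minimal }

  open PathMetricProperties metric public using (connected)
  open PathMetricProperties metric using (dist; geodesic-length; between; outsideTerminal⇒eccentric)

  poles-geodetic : ∀ w → Between graph pole₁ pole₂ w
  poles-geodetic pole₁    = between refl
  poles-geodetic pole₂    = between refl
  poles-geodetic (core _) = between refl

  long-geodesic⇒pole₂∈verts : ∀ {u v k} (p : Walk graph u v k) → IsGeodesic graph p → 2 ≤ k →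
                             pole₂ ∈ verts graph p
  long-geodesic⇒pole₂∈verts {u} {v} p geodesic 2≤k with distance≤1⊎pole₂ u v
  ... | inj₁ d≤1 = ⊥-elim (<⇒≱ (subst (2 ≤_) (geodesic-length p geodesic) 2≤k) d≤1)
  ... | inj₂ (_ , inj₁ refl) = head∈verts p
  ... | inj₂ (_ , inj₂ refl) = last∈verts p

  -- Three vertices of S on a geodesic force it to have length 2 and so to pass
  -- through pole₂ as a fourth vertex, which is one too many for diameter 2.
  pole₂∉⇒GenPos : ∀ {S} → pole₂ ∉ S → GenPos graph S
  pole₂∉⇒GenPos pole₂∉S u v _ p geodesic _ _ _ x∈S y∈S z∈S x≢y y≢z x≢z x∈p y∈p z∈p =
    <⇒≱ (subst (4 ≤_) (length-verts p) (Unique-⊆⇒length≤ four-distinct four-on-p))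
        (s≤s (subst (_≤ 2) (sym (geodesic-length p geodesic)) (distance≤2 u v)))
    where
    pole₂∈p : pole₂ ∈ verts graph p
    pole₂∈p = long-geodesic⇒pole₂∈verts p geodesic
                (distinct₃-on-walk⇒2≤length p x≢y y≢z x≢z x∈p y∈p z∈p)

    four-distinct : Unique (pole₂ ∷ _ ∷ _ ∷ _ ∷ [])
    four-distinct = (∉-∈⇒≢ pole₂∉S x∈S ∷ ∉-∈⇒≢ pole₂∉S y∈S ∷ ∉-∈⇒≢ pole₂∉S z∈S ∷ [])
                  ∷ distinct₃ x≢y y≢z x≢z

    four-on-p : pole₂ ∷ _ ∷ _ ∷ _ ∷ [] ⊆ verts graph p
    four-on-p = All.lookup (pole₂∈p ∷ x∈p ∷ y∈p ∷ z∈p ∷ [])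

  pole∉cores : ∀ {p} → (∀ i → p ≢ core i) → p ∉ cores
  pole∉cores p≢core p∈cores with i , p≡core ← ∈-tabulate⁻ {f = core} p∈cores = p≢core i p≡core

  pole∷cores-unique : ∀ {p} → p ∉ cores → Unique (p ∷ cores)
  pole∷cores-unique p∉cores = ¬Any⇒All¬ cores p∉cores ∷ tabulate⁺ core-injective

  length-pole∷cores : ∀ p → length (p ∷ cores) ≡ suc (suc n)
  length-pole∷cores _ = cong suc (length-tabulate core)

  terminalSet : List (Vertex n)
  terminalSet = pole₁ ∷ cores

  polar-geodesic : OnCommonGeodesic graph pole₂ (core zero) pole₁
  polar-geodesic = through (walk pole₂ pole₁) (dist pole₂ pole₁)
    (here refl) (there (here refl)) (there (there (here refl)))

  terminalSet-terminal : Terminal graph terminalSet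
  terminalSet-terminal = (pole∷cores-unique (pole∉cores λ _ ()) , pole₂∉⇒GenPos pole₂∉ , maximal) , witness
    where
    pole₂∉ : pole₂ ∉ terminalSet
    pole₂∉ (there pole₂∈cores) = pole∉cores (λ _ ()) pole₂∈cores

    maximal : ∀ T → Unique T → (∀ x → x ∈ terminalSet → x ∈ T) → GenPos graph T →
              ∀ x → x ∈ T → x ∈ terminalSet
    maximal _ _ _      _  pole₁    _      = here refl
    maximal _ _ _      _  (core i) _      = there (core∈cores i)
    maximal _ _ S₀⊆T gp pole₂    pole₂∈T = ⊥-elim (GenPos⇒¬OnCommonGeodesic gp
      pole₂∈T (S₀⊆T _ (there (core∈cores zero))) (S₀⊆T _ (here refl)) (λ ()) (λ ()) (λ ())
      polar-geodesic)

    witness : ∀ u → u ∉ terminalSet → TerminalWitness graph terminalSet u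
    witness pole₁    u∉ = ⊥-elim (u∉ (here refl))
    witness (core i) u∉ = ⊥-elim (u∉ (there (core∈cores i)))
    witness pole₂    _  = pole₁ , 2 , inj₁ (walk pole₂ pole₁ , dist pole₂ pole₁ , core zero , pole₁ ,
      there (core∈cores zero) , here refl , (λ ()) , there (here refl) , there (there (here refl)))

  cores⊆terminal : ∀ {S} → Terminal graph S → cores ⊆ S
  cores⊆terminal {S} (_ , witness) core∈cores with i , refl ← ∈-tabulate⁻ {f = core} core∈cores | core i ∈? S
  ... | yes core∈S = core∈S
  ... | no  core∉S with outsideTerminal⇒eccentric core∉S (witness (core i) core∉S)
  ...   | v , inj₁ 2≤d = ⊥-elim (<⇒≱ 2≤d (core-eccentricity i v))
  ...   | v , inj₂ 2≤d = ⊥-elim (<⇒≱ 2≤d (core-eccentricityʳ i v))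

  -- If S has no pole, pole₁ ∷ S avoids pole₂, so is in general position, yet it
  -- contains three vertices of the geodesic witnessing pole₁.
  terminal⇒pole : ∀ {S} → Terminal graph S → pole₁ ∈ S ⊎ pole₂ ∈ S
  terminal⇒pole {S} (_ , witness) with pole₁ ∈? S | pole₂ ∈? S
  ... | yes pole₁∈S | _           = inj₁ pole₁∈S
  ... | no _        | yes pole₂∈S = inj₂ pole₂∈S
  ... | no pole₁∉S  | no pole₂∉S
    with x , y , x∈S , y∈S , x≢y , on-geodesic ← terminalWitness⇒OnCommonGeodesic (witness pole₁ pole₁∉S) =
    ⊥-elim (GenPos⇒¬OnCommonGeodesic (pole₂∉⇒GenPos pole₂∉pole₁∷S) (here refl) (there x∈S) (there y∈S)
      (∉-∈⇒≢ pole₁∉S x∈S) x≢y (∉-∈⇒≢ pole₁∉S y∈S) on-geodesic)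
    where
    pole₂∉pole₁∷S : pole₂ ∉ pole₁ ∷ S
    pole₂∉pole₁∷S (there pole₂∈S) = pole₂∉S pole₂∈S

  terminal-length : ∀ S → Terminal graph S → suc (suc n) ≤ length S
  terminal-length S terminal = [ bound (λ _ ()) , bound (λ _ ()) ]′ (terminal⇒pole terminal)
    where
    bound : ∀ {p} → (∀ i → p ≢ core i) → p ∈ S → suc (suc n) ≤ length S
    bound {p} p≢core p∈S = subst (_≤ length S) (length-pole∷cores p)
      (Unique-⊆⇒length≤ (pole∷cores-unique (pole∉cores p≢core))
        λ { (here refl) → p∈S ; (there c∈cores) → cores⊆terminal terminal c∈cores })

  tp⁻ : TpMinus graph (just (suc (suc n)))
  tp⁻ = (terminalSet , terminalSet-terminal , length-pole∷cores pole₁) , terminal-length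

proposition2p9 : (r : ℕ) → 2 ≤ r →
    Σ Graph λ G → Σ Graph λ H →
      Connected G × Connected H ×
      HasUniversalLine (G □ H) × GpMinus (G □ H) 2 ×
      Σ (Maybe ℕ) λ a → Σ (Maybe ℕ) λ b →
        TpMinus G a × TpMinus H b × min∞ a b ≡ just r
proposition2p9 (suc (suc n)) (s≤s (s≤s z≤n)) =
  graph , graph , connected , connected ,
  universal , HasUniversalLine⇒GpMinus≡2 (≡-dec _≟_ _≟_) universal ,
  just (suc (suc n)) , just (suc (suc n)) , tp⁻ , tp⁻ , cong just (⊓-idem (suc (suc n)))
  where
  open CompleteMinusEdge n using (graph; connected; _≟_; poles-geodetic; tp⁻)

  universal : HasUniversalLine (graph □ graph)
  universal = (pole₁ , pole₁) , (pole₂ , pole₂) , (λ ()) ,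
              Between-□⇒UniversalLine poles-geodetic poles-geodetic
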